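{- For every positive integer $\ell$, $K(\ell)=\kappa(\ell K_2)$.
   Context: A natural graph is a simple graph whose vertex set is a finite subset of $\mathbb{N}=\{1,2,\dots\}$. An infinite permutation of $\mathbb{N}$ is a sequence $(\pi(1),\pi(2),\dots)$ in which every positive integer occurs exactly once. For a natural graph $G$, two infinite permutations $\pi,\sigma$ are $G$-different if $\{\pi(i),\sigma(i)\}\in E(G)$ for some $i$. $\kappa(G)$ is the maximum cardinality of a set of pairwise $G$-different infinite permutations (finite for every natural graph); it depends only on the isomorphism class of $G$. $K(\ell)=\max\{\kappa(G): G \text{ a natural graph with } |E(G)|=\ell\}$. $\ell K_2$ denotes a natural graph consisting of $\ell$ pairwise vertex-disjoint edges and no other vertices (e.g. edges $\{1,2\},\{3,4\},\dots,\{2\ell-1,2\ell\}$). -}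

module Defs where

open import Data.Nat using (ℕ; zero; suc; _+_; _*_; _≤_; _<_)
open import Data.Fin using (Fin)
open import Data.Product using (_×_; _,_; Σ; ∃)
open import Data.Sum using (_⊎_)
open import Data.List using (List; length; map; upTo)
open import Data.List.Relation.Unary.All using (All)
open import Data.List.Relation.Unary.Unique.Propositional using (Unique)
open import Data.List.Membership.Propositional using (_∈_)
open import Relation.Binary.PropositionalEquality using (_≡_; _≢_)
open import Relation.Nullary using (¬_)
open import Function.Bundles using (_⤖_; Bijection)

-- Convention: the paper's ℕ = {1,2,...} is represented by Agda's ℕ = {0,1,...}
-- via n ↦ n - 1 (a relabelling, which changes nothing).

-- Raw data of a natural graph: a vertex list and an edge list.
-- An edge {u,v} is stored once, as the pair (u , v) with u < v.
record RawGraph : Set where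
  constructor mkGraph
  field
    vertices : List ℕ
    edges    : List (ℕ × ℕ)
open RawGraph public

IsNaturalGraph : RawGraph → Set
IsNaturalGraph G =
  Unique (vertices G) ×
  Unique (edges G) ×
  All (λ e → (Data.Product.proj₁ e < Data.Product.proj₂ e) ×
             (Data.Product.proj₁ e ∈ vertices G) ×
             (Data.Product.proj₂ e ∈ vertices G)) (edges G)

numEdges : RawGraph → ℕ
numEdges G = length (edges G)

Adjacent : RawGraph → ℕ → ℕ → Set
Adjacent G a b = ((a , b) ∈ edges G) ⊎ ((b , a) ∈ edges G)

InfPerm : Set
InfPerm = ℕ ⤖ ℕ

apply : InfPerm → ℕ → ℕ
apply π = Bijection.to π

GDifferent : RawGraph → InfPerm → InfPerm → Set
GDifferent G π σ = ∃ λ i → Adjacent G (apply π i) (apply σ i)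

-- A set of m pairwise G-different infinite permutations, given as an indexed
-- family (pairwise G-different elements are automatically distinct).
GDiffFamily : RawGraph → ℕ → Set
GDiffFamily G m =
  Σ (Fin m → InfPerm) λ f → ∀ (i j : Fin m) → i ≢ j → GDifferent G (f i) (f j)

IsKappa : RawGraph → ℕ → Set
IsKappa G k = GDiffFamily G k × (∀ m → GDiffFamily G m → m ≤ k)

IsK : ℕ → ℕ → Set
IsK ℓ k =
  (Σ RawGraph λ G → IsNaturalGraph G × numEdges G ≡ ℓ × IsKappa G k) ×
  (∀ (G : RawGraph) → IsNaturalGraph G → numEdges G ≡ ℓ →
     ∀ k′ → IsKappa G k′ → k′ ≤ k)

-- ℓK₂: edges {2i, 2i+1} for i < ℓ (the paper's {1,2},{3,4},... shifted by one),
-- vertex set {0,...,2ℓ-1}.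
matching : ℕ → RawGraph
matching ℓ = mkGraph (upTo (2 * ℓ)) (map (λ i → (2 * i , suc (2 * i))) (upTo ℓ))

-- Let e₀, …, e_{ℓ-1} be the edges of G. Split the positions of ℕ into ℓ residue classes
-- c + i ℓ and send a permutation π to the permutation that, at position c + i ℓ, shows π(i)
-- relabelled by a bijection of ℕ carrying the ends of e_c to the ends of the c-th matching
-- edge {2c, 2c+1} and everything else into values reserved for class c. If π(i), σ(i) are the
-- ends of e_c, the images then differ at position c + i ℓ across that matching edge, so every
-- family of pairwise G-different permutations becomes one of pairwise ℓK₂-different ones and
-- κ(G) ≤ κ(ℓK₂).
module Submission where

open import Defs
open import Data.Nat using (ℕ; suc; _+_; _*_; _<_; _≤_; NonZero; >-nonZero; _≟_)
open import Data.Nat.Properties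
  using (+-identityʳ; *-comm; *-suc; *-cancelˡ-≡; *-monoʳ-≤; n<1+n; <-trans; <⇒≢)
open import Data.Nat.DivMod
  using (_%_; _/_; m%n<n; m≡m%n+[m/n]*n; [m+kn]%n≡m%n; m<n⇒m%n≡m; m*n%n≡0; +-distrib-/; m<n⇒m/n≡0; m*n/n≡m)
open import Data.Fin using (Fin; toℕ; fromℕ<)
open import Data.Fin.Properties using (toℕ-fromℕ<; toℕ<n; toℕ-injective)
open import Data.Product using (_×_; _,_; proj₁; proj₂)
open import Data.Product.Function.Dependent.Propositional using (Σ-↔)
open import Data.Sum using (inj₁; inj₂)
open import Data.List using (map; upTo; lookup)
open import Data.List.Properties using (length-map; length-upTo)
open import Data.List.Relation.Unary.All as All using (All)
open import Data.List.Relation.Unary.Any as Any using ()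
open import Data.List.Relation.Unary.Any.Properties using (lookup-index)
open import Data.List.Membership.Propositional using (_∈_)
open import Data.List.Membership.Propositional.Properties using (∈-map⁺; ∈-map⁻; ∈-upTo⁺; ∈-upTo⁻)
open import Data.List.Relation.Unary.Unique.Propositional.Properties using (upTo⁺; map⁺)
open import Relation.Binary.PropositionalEquality
  using (_≡_; _≢_; refl; sym; trans; cong; cong₂; subst; subst₂; module ≡-Reasoning)
open import Relation.Nullary using (yes; no; Dec)
open import Data.Empty using (⊥-elim)
open import Function using (_∘_)
open import Function.Bundles using (Inverse; _↔_; mk↔ₛ′)
open import Function.Construct.Identity using (↔-id)
open import Function.Construct.Composition using (_↔-∘_)
open import Function.Construct.Symmetry using (↔-sym)
open import Function.Properties.Bijection using (⤖⇒↔)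
open import Function.Properties.Inverse using (↔⇒⤖)

open Inverse using (to; strictlyInverseʳ)

transpose : ℕ → ℕ → ℕ → ℕ
transpose x y n with n ≟ x | n ≟ y
... | yes _ | _     = y
... | no _  | yes _ = x
... | no _  | no _  = n

transpose-left : ∀ x y → transpose x y x ≡ y
transpose-left x y with x ≟ x
... | yes _  = refl
... | no x≢x = ⊥-elim (x≢x refl)

transpose-right : ∀ x y → transpose x y y ≡ x
transpose-right x y with y ≟ x | y ≟ y
... | yes y≡x | _      = y≡x
... | no _    | yes _  = refl
... | no _    | no y≢y = ⊥-elim (y≢y refl)

transpose-other : ∀ x y {n} → n ≢ x → n ≢ y → transpose x y n ≡ n
transpose-other x y {n} n≢x n≢y with n ≟ x | n ≟ y
... | yes n≡x | _       = ⊥-elim (n≢x n≡x)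
... | no _    | yes n≡y = ⊥-elim (n≢y n≡y)
... | no _    | no _    = refl

transpose-involutive : ∀ x y n → transpose x y (transpose x y n) ≡ n
transpose-involutive x y n = by-cases n (n ≟ x) (n ≟ y)
  where
  by-cases : ∀ m → Dec (m ≡ x) → Dec (m ≡ y) → transpose x y (transpose x y m) ≡ m
  by-cases _ (yes refl) _ =
    trans (cong (transpose x y) (transpose-left x y)) (transpose-right x y)
  by-cases _ (no _) (yes refl) =
    trans (cong (transpose x y) (transpose-right x y)) (transpose-left x y)
  by-cases m (no m≢x) (no m≢y) =
    trans (cong (transpose x y) (transpose-other x y m≢x m≢y)) (transpose-other x y m≢x m≢y)

transpose-↔ : ℕ → ℕ → ℕ ↔ ℕ
transpose-↔ x y =
  mk↔ₛ′ (transpose x y) (transpose x y) (transpose-involutive x y) (transpose-involutive x y)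

sendToFront : ℕ × ℕ → ℕ ↔ ℕ
sendToFront (a , b) = transpose-↔ 1 (transpose 0 a b) ↔-∘ transpose-↔ 0 a

sendToFront-sends : ∀ {a b} → a ≢ b →
                    to (sendToFront (a , b)) a ≡ 0 × to (sendToFront (a , b)) b ≡ 1
sendToFront-sends {a} {b} a≢b = a↦0 , transpose-right 1 b′
  where
  b′ = transpose 0 a b
  b′≢0 : b′ ≢ 0
  b′≢0 b′≡0 = a≢b (begin
    a                             ≡⟨ sym (transpose-left 0 a) ⟩
    transpose 0 a 0               ≡⟨ cong (transpose 0 a) b′≡0 ⟨
    transpose 0 a b′              ≡⟨ transpose-involutive 0 a b ⟩
    b                             ∎)
    where open ≡-Reasoning
  a↦0 : transpose 1 b′ (transpose 0 a a) ≡ 0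
  a↦0 rewrite transpose-right 0 a = transpose-other 1 b′ (λ ()) (b′≢0 ∘ sym)

divMod-↔ : ∀ n .{{_ : NonZero n}} → (Fin n × ℕ) ↔ ℕ
divMod-↔ n = mk↔ₛ′ combine split combine-split split-combine
  where
  combine : Fin n × ℕ → ℕ
  combine (r , q) = toℕ r + q * n
  split : ℕ → Fin n × ℕ
  split m = fromℕ< (m%n<n m n) , m / n
  combine-split : ∀ m → combine (split m) ≡ m
  combine-split m = trans (cong (_+ m / n * n) (toℕ-fromℕ< (m%n<n m n))) (sym (m≡m%n+[m/n]*n m n))
  combine%n : ∀ r q → combine (r , q) % n ≡ toℕ r
  combine%n r q = trans ([m+kn]%n≡m%n (toℕ r) q n) (m<n⇒m%n≡m (toℕ<n r))
  combine/n : ∀ r q → combine (r , q) / n ≡ q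
  combine/n r q = begin
    (toℕ r + q * n) / n       ≡⟨ +-distrib-/ (toℕ r) (q * n) no-carry ⟩
    toℕ r / n + q * n / n     ≡⟨ cong₂ _+_ (m<n⇒m/n≡0 (toℕ<n r)) (m*n/n≡m q n) ⟩
    q                         ∎
    where
    open ≡-Reasoning
    no-carry : toℕ r % n + q * n % n < n
    no-carry = subst (_< n) (sym r%n+0) (toℕ<n r)
      where
      r%n+0 : toℕ r % n + q * n % n ≡ toℕ r
      r%n+0 = trans (cong₂ _+_ (m<n⇒m%n≡m (toℕ<n r)) (m*n%n≡0 q n)) (+-identityʳ (toℕ r))
  split-combine : ∀ p → split (combine p) ≡ p
  split-combine (r , q) = cong₂ _,_ (toℕ-injective (trans (toℕ-fromℕ< _) (combine%n r q))) (combine/n r q)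

-- (c , r + 2 q) ↦ r + 2 (c + q ℓ) for r < 2: block c owns the values 2 (c + q ℓ) + r.
blockPairs-↔ : ∀ ℓ .{{_ : NonZero ℓ}} → (Fin ℓ × ℕ) ↔ ℕ
blockPairs-↔ ℓ =
  divMod-↔ 2 ↔-∘ (Σ-↔ (↔-id _) (divMod-↔ ℓ) ↔-∘ (exchange ↔-∘ Σ-↔ (↔-id _) (↔-sym (divMod-↔ 2))))
  where
  exchange : ∀ {A B C : Set} → (A × (B × C)) ↔ (B × (A × C))
  exchange = mk↔ₛ′ (λ (a , b , c) → b , a , c) (λ (b , a , c) → a , b , c) (λ _ → refl) (λ _ → refl)

blockPairs-zero : ∀ ℓ .{{_ : NonZero ℓ}} (c : Fin ℓ) → to (blockPairs-↔ ℓ) (c , 0) ≡ 2 * toℕ c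
blockPairs-zero ℓ c = trans (*-comm (toℕ c + 0) 2) (cong (2 *_) (+-identityʳ (toℕ c)))

blockPairs-one : ∀ ℓ .{{_ : NonZero ℓ}} (c : Fin ℓ) → to (blockPairs-↔ ℓ) (c , 1) ≡ suc (2 * toℕ c)
blockPairs-one ℓ c = cong suc (blockPairs-zero ℓ c)

interleave : ∀ {ℓ} .{{_ : NonZero ℓ}} → (Fin ℓ → ℕ ↔ ℕ) → ℕ ↔ ℕ
interleave {ℓ} ψ = blockPairs-↔ ℓ ↔-∘ (Σ-↔ (↔-id _) (λ {c} → ψ c) ↔-∘ ↔-sym (divMod-↔ ℓ))

interleave-at : ∀ {ℓ} .{{_ : NonZero ℓ}} (ψ : Fin ℓ → ℕ ↔ ℕ) c i →
                to (interleave ψ) (to (divMod-↔ ℓ) (c , i)) ≡ to (blockPairs-↔ ℓ) (c , to (ψ c) i)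
interleave-at {ℓ} ψ c i =
  cong (λ (c′ , i′) → to (blockPairs-↔ ℓ) (c′ , to (ψ c′) i′)) (strictlyInverseʳ (divMod-↔ ℓ) (c , i))

Adjacent-sym : ∀ G {a b} → Adjacent G a b → Adjacent G b a
Adjacent-sym _ (inj₁ ab∈) = inj₂ ab∈
Adjacent-sym _ (inj₂ ba∈) = inj₁ ba∈

GDifferent-sym : ∀ G π σ → GDifferent G π σ → GDifferent G σ π
GDifferent-sym G _ _ (i , adj) = i , Adjacent-sym G adj

matching-adjacent : ∀ {ℓ c} → c < ℓ → Adjacent (matching ℓ) (2 * c) (suc (2 * c))
matching-adjacent c<ℓ = inj₁ (∈-map⁺ (λ i → 2 * i , suc (2 * i)) (∈-upTo⁺ c<ℓ))

Loopless : RawGraph → Set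
Loopless G = All (λ (a , b) → a ≢ b) (edges G)

isNaturalGraph⇒loopless : ∀ {G} → IsNaturalGraph G → Loopless G
isNaturalGraph⇒loopless (_ , _ , ordered) = All.map (λ (a<b , _) → <⇒≢ a<b) ordered

module _ (G : RawGraph) .{{_ : NonZero (numEdges G)}} where

  private
    ℓ = numEdges G

  edgeToFront : InfPerm → Fin ℓ → ℕ ↔ ℕ
  edgeToFront π c = sendToFront (lookup (edges G) c) ↔-∘ ⤖⇒↔ π

  toMatching : InfPerm → InfPerm
  toMatching π = ↔⇒⤖ (interleave (edgeToFront π))

  toMatching-edge : ∀ π σ {i} (e : (apply π i , apply σ i) ∈ edges G) → apply π i ≢ apply σ i →
                    GDifferent (matching ℓ) (toMatching π) (toMatching σ)
  toMatching-edge π σ {i} e π≢σ =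
    to (divMod-↔ ℓ) (c , i) ,
    subst₂ (Adjacent (matching ℓ)) (sym π-lands) (sym σ-lands) (matching-adjacent (toℕ<n c))
    where
    open ≡-Reasoning
    c = Any.index e
    front = sendToFront (lookup (edges G) c)
    block : ℕ → ℕ
    block j = to (blockPairs-↔ ℓ) (c , j)
    fronted : to front (apply π i) ≡ 0 × to front (apply σ i) ≡ 1
    fronted = subst (λ p → to (sendToFront p) (apply π i) ≡ 0 × to (sendToFront p) (apply σ i) ≡ 1)
                    (lookup-index e) (sendToFront-sends π≢σ)
    π-lands : apply (toMatching π) (to (divMod-↔ ℓ) (c , i)) ≡ 2 * toℕ c
    π-lands = begin
      apply (toMatching π) (to (divMod-↔ ℓ) (c , i))  ≡⟨ interleave-at (edgeToFront π) c i ⟩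
      block (to front (apply π i))                     ≡⟨ cong block (proj₁ fronted) ⟩
      block 0                                          ≡⟨ blockPairs-zero ℓ c ⟩
      2 * toℕ c                                        ∎
    σ-lands : apply (toMatching σ) (to (divMod-↔ ℓ) (c , i)) ≡ suc (2 * toℕ c)
    σ-lands = begin
      apply (toMatching σ) (to (divMod-↔ ℓ) (c , i))  ≡⟨ interleave-at (edgeToFront σ) c i ⟩
      block (to front (apply σ i))                     ≡⟨ cong block (proj₂ fronted) ⟩
      block 1                                          ≡⟨ blockPairs-one ℓ c ⟩
      suc (2 * toℕ c)                                  ∎

  toMatching-GDifferent : Loopless G → ∀ π σ → GDifferent G π σ →
                          GDifferent (matching ℓ) (toMatching π) (toMatching σ)
  toMatching-GDifferent loopless π σ (i , inj₁ e) = toMatching-edge π σ {i} e (All.lookup loopless e)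
  toMatching-GDifferent loopless π σ (i , inj₂ e) =
    GDifferent-sym (matching ℓ) (toMatching σ) (toMatching π) (toMatching-edge σ π {i} e (All.lookup loopless e))

GDiffFamily-map : ∀ {G H m} (T : InfPerm → InfPerm) → (∀ π σ → GDifferent G π σ → GDifferent H (T π) (T σ)) →
                  GDiffFamily G m → GDiffFamily H m
GDiffFamily-map T T-different (f , f-different) =
  T ∘ f , λ i j i≢j → T-different (f i) (f j) (f-different i j i≢j)

κ≤κ-matching : ∀ {G k k′} → IsNaturalGraph G → 1 ≤ numEdges G →
               IsKappa (matching (numEdges G)) k → IsKappa G k′ → k′ ≤ k
κ≤κ-matching {G} {k′ = k′} natural 1≤ℓ (_ , maximal) (family , _) =
  maximal k′ (GDiffFamily-map {G} {matching (numEdges G)}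
                (toMatching G) (toMatching-GDifferent G (isNaturalGraph⇒loopless natural)) family)
  where instance _ = >-nonZero 1≤ℓ

matching-isNaturalGraph : ∀ ℓ → IsNaturalGraph (matching ℓ)
matching-isNaturalGraph ℓ = upTo⁺ (2 * ℓ) , map⁺ edge-injective (upTo⁺ ℓ) , All.tabulate edge-ok
  where
  edge : ℕ → ℕ × ℕ
  edge i = 2 * i , suc (2 * i)
  edge-injective : ∀ {i j} → edge i ≡ edge j → i ≡ j
  edge-injective eq = *-cancelˡ-≡ _ _ 2 (cong proj₁ eq)
  edge-ok : ∀ {e} → e ∈ map edge (upTo ℓ) →
            (proj₁ e < proj₂ e) × (proj₁ e ∈ upTo (2 * ℓ)) × (proj₂ e ∈ upTo (2 * ℓ))
  edge-ok e∈ with ∈-map⁻ edge e∈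
  ... | i , i∈ , refl = n<1+n _ , ∈-upTo⁺ (<-trans (n<1+n _) 2i+1<2ℓ) , ∈-upTo⁺ 2i+1<2ℓ
    where
    2i+1<2ℓ : suc (2 * i) < 2 * ℓ
    2i+1<2ℓ = subst (_≤ 2 * ℓ) (*-suc 2 i) (*-monoʳ-≤ 2 (∈-upTo⁻ i∈))

matching-numEdges : ∀ ℓ → numEdges (matching ℓ) ≡ ℓ
matching-numEdges ℓ = trans (length-map _ (upTo ℓ)) (length-upTo ℓ)

corollary1 : ∀ (ℓ : ℕ) → 1 ≤ ℓ → ∀ (k : ℕ) → IsKappa (matching ℓ) k → IsK ℓ k
corollary1 ℓ 1≤ℓ k κ-matching =
  (matching ℓ , matching-isNaturalGraph ℓ , matching-numEdges ℓ , κ-matching) ,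
  λ { G natural refl k′ κ-G → κ≤κ-matching natural 1≤ℓ κ-matching κ-G }
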